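{- For every $n\geq 3$, the directed cycle $C_n$ admits a strong SA$(n+1,1)$AL (a strong total labeling whose subtractive arc-weights are exactly $n+1,\ldots,2n$) and a strong SV$(1,1)$AL (a strong total labeling whose subtractive vertex-weights are exactly $1,\ldots,n$).
   Context: The directed cycle $C_n$, $n\geq 3$, has vertices $v_1,\ldots,v_n$ and arcs $v_iv_{i+1}$ ($1\le i\le n-1$) and $v_nv_1$. For a digraph $G=(V,A)$, a total labeling is a bijection $\lambda:V\cup A\to\{1,2,\ldots,|V|+|A|\}$. For an arc $xy$ (tail $x$, head $y$), $wt^-(xy)=\lambda(xy)+\lambda(y)-\lambda(x)$; for a vertex $x$, $wt^-(x)=\lambda(x)+\sum_{yx\in A}\lambda(yx)-\sum_{xy\in A}\lambda(xy)$. An SA$(a,d)$AL is a total labeling whose set of subtractive arc-weights is $\{a,a+d,\ldots,a+(|A|-1)d\}$ (all distinct); an SV$(a,d)$AL is a total labeling whose set of subtractive vertex-weights is $\{a,a+d,\ldots,a+(|V|-1)d\}$ (all distinct). A total labeling is strong if $\lambda(V)=\{1,\ldots,|V|\}$. -}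

module Defs where

open import Data.Nat using (ℕ; suc; _+_; _<_; _%_)
import Data.Nat
open import Data.Nat.DivMod using (m%n<n)
open import Data.Fin using (Fin; toℕ; fromℕ<; _≟_)
open import Data.Sum using (_⊎_; inj₁; inj₂)
open import Data.Product using (Σ; _×_; _,_; ∃-syntax)
open import Data.Integer using (ℤ; +_; _-_; _*_) renaming (_+_ to _+ℤ_)
open import Data.List using (List; []; _∷_; allFin)
open import Relation.Binary.PropositionalEquality using (_≡_)
open import Relation.Nullary using (yes; no)
open import Function.Definitions using (Injective; Bijective)

record Digraph : Set where
  field
    nv   : ℕ
    na   : ℕ
    tail : Fin na → Fin nv
    head : Fin na → Fin nv
open Digraph public

next : ∀ {n} → Fin n → Fin n
next {suc n} i = fromℕ< (m%n<n (toℕ i + 1) (suc n))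

-- The directed cycle C_n: vertex i (0-based, i.e. v_{i+1}); arc i goes from
-- vertex i to vertex (i+1 mod n), i.e. arcs v_i v_{i+1} and v_n v_1.
cycle : ℕ → Digraph
cycle n = record { nv = n ; na = n ; tail = λ i → i ; head = next }

Elem : Digraph → Set
Elem G = Fin (nv G) ⊎ Fin (na G)

-- A total labeling: a bijection V ∪ A → {1,…,|V|+|A|}; {1,…,N} is encoded
-- as Fin N, the label of x being toℕ (f x) + 1.
record TotalLabeling (G : Digraph) : Set where
  field
    f   : Elem G → Fin (nv G + na G)
    bij : Bijective _≡_ _≡_ f
open TotalLabeling public

label : ∀ {G} → TotalLabeling G → Elem G → ℕ
label L x = suc (toℕ (f L x))

vlab : ∀ {G} → TotalLabeling G → Fin (nv G) → ℤ
vlab L v = + label L (inj₁ v)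

alab : ∀ {G} → TotalLabeling G → Fin (na G) → ℤ
alab L e = + label L (inj₂ e)

sumList : ∀ {m k} → (Fin m → ℤ) → (Fin m → Fin k) → Fin k → List (Fin m) → ℤ
sumList g end x [] = + 0
sumList g end x (e ∷ es) with end e ≟ x
... | yes _ = g e +ℤ sumList g end x es
... | no  _ = sumList g end x es

sumAt : ∀ {m k} → (Fin m → ℤ) → (Fin m → Fin k) → Fin k → ℤ
sumAt {m} g end x = sumList g end x (allFin m)

arcWt : ∀ {G} → TotalLabeling G → Fin (na G) → ℤ
arcWt {G} L e = (alab L e +ℤ vlab L (head G e)) - vlab L (tail G e)

vertWt : ∀ {G} → TotalLabeling G → Fin (nv G) → ℤ
vertWt {G} L x = (vlab L x +ℤ sumAt (alab L) (head G) x) - sumAt (alab L) (tail G) x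

IsAP : ∀ {m} → (Fin m → ℤ) → ℤ → ℤ → Set
IsAP {m} w a d =
  Injective _≡_ _≡_ w
  × (∀ x → ∃[ k ] (k < m × w x ≡ a +ℤ (+ k) * d))
  × (∀ k → k < m → ∃[ x ] (w x ≡ a +ℤ (+ k) * d))

Strong : ∀ {G} → TotalLabeling G → Set
Strong {G} L = (∀ v → label L (inj₁ v) Data.Nat.≤ nv G)
  × (∀ k → 1 Data.Nat.≤ k → k Data.Nat.≤ nv G → ∃[ v ] (label L (inj₁ v) ≡ k))

SAAL : ∀ {G} → TotalLabeling G → ℤ → ℤ → Set
SAAL L a d = IsAP (arcWt L) a d

SVAL : ∀ {G} → TotalLabeling G → ℤ → ℤ → Set
SVAL L a d = IsAP (vertWt L) a d

-- Label the vertices v₁,…,vₙ of Cₙ by 1,…,n and the arc leaving vᵢ by n+i.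
-- Every vertex is the tail of exactly one arc and the head of exactly one, so
-- (indices mod n) wt⁻(vᵢvᵢ₊₁) = n + λ(vᵢ₊₁) and wt⁻(vᵢ) = λ(vᵢ₋₁). As i ↦ i ± 1
-- permutes the vertices, the arc weights run through n+1,…,2n and the vertex
-- weights through 1,…,n.
module Submission where

open import Defs
open import Data.Nat using (ℕ; _≥_)
open import Data.Integer using (+_)
open import Data.Product using (Σ; _×_)

import Data.Integer.Properties as ℤ
open import Algebra.Properties.AbelianGroup ℤ.+-0-abelianGroup using (∙-cancelˡ)
open import Data.Fin using (Fin; zero; suc; toℕ; fromℕ; fromℕ<; inject₁; join; _≟_)
open import Data.Fin.Properties
  using (toℕ-injective; toℕ-fromℕ; toℕ-fromℕ<; toℕ-inject₁; toℕ-↑ˡ; toℕ-↑ʳ; toℕ<n; +↔⊎)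
open import Data.Integer using (ℤ; _+_; _-_; _*_; NonZero)
open import Data.Integer.Tactic.RingSolver using (solve-∀)
open import Data.List using (_∷_)
open import Data.List.Membership.Propositional using (_∈_)
open import Data.List.Membership.Propositional.Properties using (∈-allFin)
open import Data.List.Relation.Unary.All as All using (All; []; _∷_)
open import Data.List.Relation.Unary.Any using (here; there)
open import Data.List.Relation.Unary.Unique.Propositional using (Unique; _∷_)
open import Data.List.Relation.Unary.Unique.Propositional.Properties using (allFin⁺)
open import Data.Nat using (suc; _<_; _≤_; _%_; s≤s) renaming (_+_ to _+ℕ_)
open import Data.Nat.Properties using (+-comm)
open import Data.Nat.DivMod using (n%n≡0; m<n⇒m%n≡m)
open import Data.Product using (_,_; ∃-syntax)
open import Data.Sum using (inj₁)
open import Function.Bundles using (Bijection)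
open import Function.Definitions using (Injective)
open import Function.Properties.Inverse using (Inverse⇒Bijection; ↔-sym)
open import Relation.Binary.PropositionalEquality
open import Relation.Nullary using (yes; no; contradiction)
open ≡-Reasoning

data LastOrInject₁ {m : ℕ} : Fin (suc m) → Set where
  last     : LastOrInject₁ (fromℕ m)
  inject₁⁺ : (i : Fin m) → LastOrInject₁ (inject₁ i)

lastOrInject₁ : ∀ {m} (i : Fin (suc m)) → LastOrInject₁ i
lastOrInject₁ {ℕ.zero} zero = last
lastOrInject₁ {suc m} zero = inject₁⁺ zero
lastOrInject₁ {suc m} (suc i) with lastOrInject₁ i
... | last       = last
... | inject₁⁺ j = inject₁⁺ (suc j)

next-fromℕ : ∀ m → next (fromℕ m) ≡ zero
next-fromℕ m = toℕ-injective (begin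
  toℕ (next (fromℕ m))         ≡⟨ toℕ-fromℕ< _ ⟩
  (toℕ (fromℕ m) +ℕ 1) % suc m ≡⟨ cong (λ k → (k +ℕ 1) % suc m) (toℕ-fromℕ m) ⟩
  (m +ℕ 1) % suc m             ≡⟨ cong (_% suc m) (+-comm m 1) ⟩
  suc m % suc m                ≡⟨ n%n≡0 (suc m) ⟩
  0                            ∎)

next-inject₁ : ∀ {m} (i : Fin m) → next (inject₁ i) ≡ suc i
next-inject₁ {m} i = toℕ-injective (begin
  toℕ (next (inject₁ i))         ≡⟨ toℕ-fromℕ< _ ⟩
  (toℕ (inject₁ i) +ℕ 1) % suc m ≡⟨ cong (λ k → (k +ℕ 1) % suc m) (toℕ-inject₁ i) ⟩
  (toℕ i +ℕ 1) % suc m           ≡⟨ cong (_% suc m) (+-comm (toℕ i) 1) ⟩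
  suc (toℕ i) % suc m            ≡⟨ m<n⇒m%n≡m (s≤s (toℕ<n i)) ⟩
  suc (toℕ i)                    ∎)

prev : ∀ {m} → Fin (suc m) → Fin (suc m)
prev {m} zero = fromℕ m
prev (suc i)  = inject₁ i

prev-next : ∀ {m} (i : Fin (suc m)) → prev (next i) ≡ i
prev-next {m} i with lastOrInject₁ i
... | last       rewrite next-fromℕ m = refl
... | inject₁⁺ j rewrite next-inject₁ j = refl

next-prev : ∀ {m} (i : Fin (suc m)) → next (prev i) ≡ i
next-prev {m} zero = next-fromℕ m
next-prev (suc i)  = next-inject₁ i

next-injective : ∀ {m} → Injective _≡_ _≡_ (next {suc m})
next-injective {x = i} {j} eq = begin
  i             ≡⟨ prev-next i ⟨
  prev (next i) ≡⟨ cong prev eq ⟩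
  prev (next j) ≡⟨ prev-next j ⟩
  j             ∎

module _ {m k} (g : Fin m → ℤ) (end : Fin m → Fin k) {x : Fin k} where

  sumList-none : ∀ {es} → All (λ e → end e ≢ x) es → sumList g end x es ≡ + 0
  sumList-none [] = refl
  sumList-none {e ∷ _} (e↛x ∷ es↛x) with end e ≟ x
  ... | yes e→x = contradiction e→x e↛x
  ... | no  _   = sumList-none es↛x

  sumList-unique : ∀ {e es} → (∀ {e′} → end e′ ≡ x → e′ ≡ e) → end e ≡ x →
                   e ∈ es → Unique es → sumList g end x es ≡ g e
  sumList-unique {e} {_ ∷ es} only-e e→x (here refl) (e∉es ∷ _) with end e ≟ x
  ... | yes _   = begin
    g e + sumList g end x es ≡⟨ cong (_+_ (g e)) (sumList-none es↛x) ⟩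
    g e + + 0               ≡⟨ ℤ.+-identityʳ (g e) ⟩
    g e                     ∎
    where
    es↛x : All (λ e′ → end e′ ≢ x) es
    es↛x = All.map (λ e≢e′ e′→x → e≢e′ (sym (only-e e′→x))) e∉es
  ... | no  e↛x = contradiction e→x e↛x
  sumList-unique {es = e′ ∷ _} only-e e→x (there e∈es) (e′∉es ∷ es-unique) with end e′ ≟ x
  ... | yes e′→x = contradiction (only-e e′→x) (All.lookup e′∉es e∈es)
  ... | no  _    = sumList-unique only-e e→x e∈es es-unique

sumAt-injective : ∀ {m k} (g : Fin m → ℤ) {end : Fin m → Fin k} → Injective _≡_ _≡_ end →
                  ∀ {x e} → end e ≡ x → sumAt g end x ≡ g e
sumAt-injective g end-injective {x} {e} e→x =
  sumList-unique g _ (λ e′→x → end-injective (trans e′→x (sym e→x))) e→x (∈-allFin e) (allFin⁺ _)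

isAP-permuted : ∀ {m} (w : Fin m → ℤ) (a d : ℤ) .{{_ : NonZero d}} (σ τ : Fin m → Fin m) →
                (∀ i → τ (σ i) ≡ i) → (∀ i → σ (τ i) ≡ i) →
                (∀ i → w i ≡ a + + toℕ (σ i) * d) → IsAP w a d
isAP-permuted {m} w a d σ τ τσ στ w≡ = injective , (λ i → toℕ (σ i) , toℕ<n (σ i) , w≡ i) , surjective
  where
  injective : Injective _≡_ _≡_ w
  injective {i} {j} wi≡wj = begin
    i         ≡⟨ τσ i ⟨
    τ (σ i)   ≡⟨ cong τ (toℕ-injective (ℤ.+-injective (ℤ.*-cancelʳ-≡ _ _ d
                   (∙-cancelˡ a _ _ (trans (sym (w≡ i)) (trans wi≡wj (w≡ j))))))) ⟩
    τ (σ j)   ≡⟨ τσ j ⟩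
    j         ∎

  surjective : ∀ k → k < m → ∃[ i ] (w i ≡ a + + k * d)
  surjective k k<m = τ (fromℕ< k<m) , (begin
    w (τ (fromℕ< k<m))                   ≡⟨ w≡ _ ⟩
    a + + toℕ (σ (τ (fromℕ< k<m))) * d  ≡⟨ cong (λ i → a + + toℕ i * d) (στ _) ⟩
    a + + toℕ (fromℕ< k<m) * d          ≡⟨ cong (λ n → a + + n * d) (toℕ-fromℕ< k<m) ⟩
    a + + k * d                          ∎)

vertexFirst : (G : Digraph) → TotalLabeling G
vertexFirst G = record
  { f   = join (nv G) (na G)
  ; bij = Bijection.bijective (Inverse⇒Bijection (↔-sym +↔⊎))
  }

module _ (G : Digraph) where

  private
    L = vertexFirst G

  vertexFirst-vlab : ∀ v → vlab L v ≡ + suc (toℕ v)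
  vertexFirst-vlab v = cong (λ k → + suc k) (toℕ-↑ˡ v (na G))

  vertexFirst-alab : ∀ e → alab L e ≡ + suc (nv G +ℕ toℕ e)
  vertexFirst-alab e = cong (λ k → + suc k) (toℕ-↑ʳ (nv G) e)

  vertexFirst-strong : Strong L
  vertexFirst-strong = bounded , onto
    where
    bounded : ∀ v → label L (inj₁ v) ≤ nv G
    bounded v = subst (_≤ nv G) (sym (ℤ.+-injective (vertexFirst-vlab v))) (toℕ<n v)

    onto : ∀ k → 1 ≤ k → k ≤ nv G → ∃[ v ] (label L (inj₁ v) ≡ k)
    onto (suc k) _ k<nv =
      fromℕ< k<nv , trans (ℤ.+-injective (vertexFirst-vlab _)) (cong suc (toℕ-fromℕ< k<nv))

  vertexFirst-arcWt : ∀ e →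
    arcWt L e ≡ (+ suc (nv G +ℕ toℕ e) + + suc (toℕ (head G e))) - + suc (toℕ (tail G e))
  vertexFirst-arcWt e = cong₂ _-_ (cong₂ _+_ (vertexFirst-alab e) (vertexFirst-vlab (head G e)))
                                  (vertexFirst-vlab (tail G e))

  vertexFirst-vertWt : Injective _≡_ _≡_ (head G) → Injective _≡_ _≡_ (tail G) →
    ∀ {v eᵢₙ eₒᵤₜ} → head G eᵢₙ ≡ v → tail G eₒᵤₜ ≡ v →
    vertWt L v ≡ (+ suc (toℕ v) + + suc (nv G +ℕ toℕ eᵢₙ)) - + suc (nv G +ℕ toℕ eₒᵤₜ)
  vertexFirst-vertWt head-injective tail-injective {v} {eᵢₙ} {eₒᵤₜ} eᵢₙ→v v→eₒᵤₜ =
    cong₂ _-_ (cong₂ _+_ (vertexFirst-vlab v)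
                         (trans (sumAt-injective (alab L) head-injective eᵢₙ→v) (vertexFirst-alab eᵢₙ)))
              (trans (sumAt-injective (alab L) tail-injective v→eₒᵤₜ) (vertexFirst-alab eₒᵤₜ))

-- On +_ images, ℤ addition computes to ℕ addition, so the label sums are
-- definitionally the polynomials in the identities below.
module _ (m : ℕ) where

  private
    n = suc m
    L = vertexFirst (cycle n)

  cycle-arcWt : ∀ i → arcWt L i ≡ + (n +ℕ 1) + + toℕ (next i) * + 1
  cycle-arcWt i = trans (vertexFirst-arcWt (cycle n) i) (rearrange (+ n) (+ toℕ i) (+ toℕ (next i)))
    where
    rearrange : ∀ (n i j : ℤ) → ((+ 1 + (n + i)) + (+ 1 + j)) - (+ 1 + i) ≡ (n + + 1) + j * + 1
    rearrange = solve-∀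

  cycle-vertWt : ∀ i → vertWt L i ≡ + 1 + + toℕ (prev i) * + 1
  cycle-vertWt i = trans (vertexFirst-vertWt (cycle n) next-injective (λ eq → eq) (next-prev i) refl)
                         (rearrange (+ n) (+ toℕ i) (+ toℕ (prev i)))
    where
    rearrange : ∀ (n i j : ℤ) → (+ 1 + i + (+ 1 + (n + j))) - (+ 1 + (n + i)) ≡ + 1 + j * + 1
    rearrange = solve-∀

mainTheorem6 : (n : ℕ) → n ≥ 3 →
    Σ (TotalLabeling (cycle n)) (λ L → Strong L × SAAL L (+ (n Data.Nat.+ 1)) (+ 1))
    × Σ (TotalLabeling (cycle n)) (λ L → Strong L × SVAL L (+ 1) (+ 1))
-- The construction works for every n ≥ 1.
mainTheorem6 (suc m) _ =
    (L , vertexFirst-strong Cₙ , arcs-AP)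
  , (L , vertexFirst-strong Cₙ , vertices-AP)
  where
  Cₙ = cycle (suc m)
  L  = vertexFirst Cₙ

  arcs-AP : SAAL L (+ (suc m +ℕ 1)) (+ 1)
  arcs-AP = isAP-permuted (arcWt L) (+ (suc m +ℕ 1)) (+ 1) next prev prev-next next-prev (cycle-arcWt m)

  vertices-AP : SVAL L (+ 1) (+ 1)
  vertices-AP = isAP-permuted (vertWt L) (+ 1) (+ 1) prev next next-prev prev-next (cycle-vertWt m)
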